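{- Let $F\in\mathcal{SF}_n$ and let $v_1,v_2,\dots,v_k$ be an ordered listing of the non-root vertices of $F$. Define $F_0=\hat0$, the forest on $[n]$ with no edges in which every vertex is a root. For $1\le i\le k$, let $F_i$ be obtained from $F_{i-1}$ by adding the edge $\{v_i,p(v_i)\}$ and setting $R(F_i)=R(F_{i-1})\setminus\{v_i\}$. Then $F_k=F$, and the sequence $\hat0=F_0,F_1,\dots,F_k=F$ is a saturated chain in $\mathcal{SF}_n$ if and only if the listing $v_1,\dots,v_k$ is a linear extension.
   Context: A rooted spanning forest on $[n]$ is a spanning forest of the complete graph on $[n]$ with one distinguished vertex (root) in each connected component. $\mathcal{SF}_n$ is the set of such forests, with $F_1\le F_2$ iff $E(F_1)\subseteq E(F_2)$ and $R(F_2)\subseteq R(F_1)$, where $E$ is the edge set and $R$ the root set. Equivalently, $F_1\lessdot F_2$ iff $F_2$ is obtained from $F_1$ by adding an edge $\{x,y\}$ with $x,y\in R(F_1)$ and removing exactly one of $x,y$ from the set of roots. In $F$, $x$ is the parent $p(y)$ of $y$ if $\{x,y\}$ is an edge on the path from $y$ to the root of its component. $x$ is an ancestor of $y$ (and $y$ a descendant of $x$) if $x$ lies on the path from $y$ to the root of its component. A listing $v_1,\dots,v_k$ is a linear extension if whenever $v_i$ is a descendant of $v_j$ (with $v_i\neq v_j$) we have $i<j$. -}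

module Defs where

open import Level using (0ℓ)
open import Data.Nat using (ℕ; zero; suc; _<_; _≤_)
open import Data.Fin using (Fin)
open import Data.List using (List; []; _∷_; length; take; last; lookup)
open import Data.Maybe using (just)
open import Data.Product using (Σ; ∃; ∃-syntax; _×_; _,_)
open import Data.Sum using (_⊎_)
open import Relation.Nullary using (¬_)
open import Relation.Binary.PropositionalEquality using (_≡_; _≢_)
open import Relation.Binary.Construct.Closure.ReflexiveTransitive using (Star)
open import Data.List.Relation.Unary.Linked using (Linked)
open import Data.List.Relation.Unary.Unique.Propositional using (Unique)
open import Data.List.Membership.Propositional using (_∈_)
open import Function.Bundles using (_⇔_)

-- A "rooted graph" on [n] = Fin n : an edge relation (to be symmetric, i.e.
-- an undirected edge {a,b} is represented by E a b and E b a) and a root set.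
record RGraph (n : ℕ) : Set₁ where
  field
    E : Fin n → Fin n → Set
    R : Fin n → Set
open RGraph public

_≈G_ : ∀ {n} → RGraph n → RGraph n → Set
G ≈G H = (∀ a b → E G a b ⇔ E H a b) × (∀ z → R G z ⇔ R H z)

Conn : ∀ {n} → RGraph n → Fin n → Fin n → Set
Conn G = Star (E G)

IsCycle : ∀ {n} → RGraph n → List (Fin n) → Set
IsCycle G []                    = Data.Empty.⊥ where import Data.Empty
IsCycle G (x ∷ [])              = Data.Empty.⊥ where import Data.Empty
IsCycle G (x ∷ y ∷ [])          = Data.Empty.⊥ where import Data.Empty
IsCycle G c@(x ∷ y ∷ z ∷ rest)  =
  Unique c × Linked (E G) c × (∃[ w ] (last c ≡ just w × E G w x))

IsRSF : ∀ {n} → RGraph n → Set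
IsRSF G =
  (∀ a b → E G a b → E G b a) ×
  (∀ a → ¬ E G a a) ×
  (∀ c → ¬ IsCycle G c) ×
  (∀ x → ∃[ r ] (R G r × Conn G x r)) ×
  (∀ x r r′ → R G r → R G r′ → Conn G x r → Conn G x r′ → r ≡ r′)

PathFromTo : ∀ {n} → RGraph n → Fin n → Fin n → List (Fin n) → Set
PathFromTo G y r []      = Data.Empty.⊥ where import Data.Empty
PathFromTo G y r (u ∷ l) =
  u ≡ y × Unique (u ∷ l) × Linked (E G) (u ∷ l) × last (u ∷ l) ≡ just r

PathToRoot : ∀ {n} → RGraph n → Fin n → List (Fin n) → Set
PathToRoot G y l = ∃[ r ] (R G r × PathFromTo G y r l)

-- x is the parent p(y) of y: {x,y} is an edge on the path from y to its root
-- (since the path starts at y and is simple, this edge is its first step).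
Parent : ∀ {n} → RGraph n → Fin n → Fin n → Set
Parent G x y = ∃[ l ] (PathToRoot G y (y ∷ x ∷ l))

Ancestor : ∀ {n} → RGraph n → Fin n → Fin n → Set
Ancestor G x y = ∃[ l ] (PathToRoot G y l × x ∈ l)

bot : ∀ {n} → RGraph n
bot = record { E = λ _ _ → Data.Empty.⊥ ; R = λ _ → Data.Unit.⊤ }
  where import Data.Empty; import Data.Unit

step : ∀ {n} → RGraph n → RGraph n → Fin n → RGraph n
step F G v = record
  { E = λ a b → E G a b ⊎ (a ≡ v × Parent F b v) ⊎ (b ≡ v × Parent F a v)
  ; R = λ z → R G z × z ≢ v }

addAll : ∀ {n} → RGraph n → RGraph n → List (Fin n) → RGraph n
addAll F G []       = G
addAll F G (v ∷ vs) = addAll F (step F G v) vs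

chainF : ∀ {n} → RGraph n → List (Fin n) → ℕ → RGraph n
chainF F vs i = addAll F bot (take i vs)

_⋖_ : ∀ {n} → RGraph n → RGraph n → Set
G₁ ⋖ G₂ = ∃[ x ] ∃[ y ] (R G₁ x × R G₁ y × x ≢ y ×
  (∀ a b → E G₂ a b ⇔ (E G₁ a b ⊎ (a ≡ x × b ≡ y) ⊎ (a ≡ y × b ≡ x))) ×
  (∀ z → R G₂ z ⇔ (R G₁ z × z ≢ y)))

SaturatedChain : ∀ {n} → (ℕ → RGraph n) → ℕ → Set
SaturatedChain Gs k =
  (∀ i → i ≤ k → IsRSF (Gs i)) × (∀ i → i < k → Gs i ⋖ Gs (suc i))

IsListing : ∀ {n} → RGraph n → List (Fin n) → Set
IsListing F vs = Unique vs × (∀ x → (¬ R F x) ⇔ (x ∈ vs))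

IsLinearExt : ∀ {n} → RGraph n → List (Fin n) → Set
IsLinearExt F vs = ∀ (i j : Fin (length vs)) → lookup vs i ≢ lookup vs j →
  Ancestor F (lookup vs j) (lookup vs i) → Data.Fin._<_ i j
  where import Data.Fin

module Submission where

-- For a set P of non-roots of the forest F, write Grown P for 0̂ with the
-- edges {v, p(v)}, v ∈ P, added and P removed from the roots; the chain is
-- F_i = Grown (v_1, ..., v_i).  The proof rests on three facts about F:
--   * Grown P is a rooted spanning forest for EVERY set P of non-roots
--     (climbing parents from x, the first vertex outside P is its root);
--   * Grown (all non-roots) = F, since every edge of F is a parent edge;
--   * Grown P ⋖ Grown (P ∪ {v}) iff p(v) ∉ P, i.e. the new edge joins two roots.
-- Hence the chain is automatically a chain of forests, and it is saturated
-- iff every vertex is listed before its parent.  Since the ancestors of a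
-- vertex are exactly the vertices reached by iterating the parent map, this
-- holds iff the listing is a linear extension.

open import Defs
open import Data.Nat using (ℕ; suc; _<_; s≤s; z≤n)
import Data.Nat.Properties as ℕ
open import Data.Fin using (Fin; toℕ; fromℕ<; _≟_)
import Data.Fin as Fin
import Data.Fin.Properties as Fin
open import Data.List using (List; []; _∷_; length; take; last; lookup)
open import Data.List.Properties using (take-all)
open import Data.Maybe using (just)
open import Data.Product using (∃-syntax; _×_; _,_; proj₁; proj₂)
open import Data.Sum using (_⊎_; inj₁; inj₂; [_,_]; swap)
import Data.Sum as Sum
open import Data.Empty using (⊥; ⊥-elim)
open import Data.Unit using (tt)
open import Function using (_∘_)
open import Function.Bundles using (_⇔_; mk⇔; Equivalence)
open import Relation.Nullary using (¬_; yes; no)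
open import Relation.Binary.PropositionalEquality using (_≡_; _≢_; refl; sym; subst)
open import Relation.Binary.Definitions using (DecidableEquality)
open import Relation.Binary.Construct.Closure.ReflexiveTransitive using (Star; ε; _◅_; _◅◅_)
import Relation.Binary.Construct.Closure.ReflexiveTransitive as Star
open import Data.List.Relation.Unary.Linked using (Linked; [-]; _∷_)
import Data.List.Relation.Unary.Linked as Linked
open import Data.List.Relation.Unary.Unique.Propositional using (Unique)
open import Data.List.Relation.Unary.AllPairs using ([]; _∷_)
open import Data.List.Relation.Unary.All using (All; []; _∷_)
import Data.List.Relation.Unary.All as All
open import Data.List.Relation.Unary.All.Properties using (¬Any⇒All¬)
open import Data.List.Relation.Unary.Any using (here; there; index)
open import Data.List.Relation.Unary.Any.Properties using (lookup-index)
open import Data.List.Membership.Propositional using (_∈_; _∉_)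
open import Data.List.Membership.Propositional.Properties using (∈-lookup)

module Paths {A : Set} (_≟A_ : DecidableEquality A) (Rel : A → A → Set) where
  open import Data.List.Membership.DecPropositional _≟A_ using (_∈?_)

  SimplePath : A → A → List A → Set
  SimplePath a b l = Unique (a ∷ l) × Linked Rel (a ∷ l) × last (a ∷ l) ≡ just b

  last∈ : ∀ (a : A) l {b} → last (a ∷ l) ≡ just b → b ∈ a ∷ l
  last∈ a []      refl = here refl
  last∈ a (x ∷ l) end  = there (last∈ x l end)

  suffixFrom : ∀ {a m b} l → a ∈ m ∷ l → SimplePath m b l → ∃[ s ] SimplePath a b s
  suffixFrom l       (here refl) p                  = l , p
  suffixFrom (_ ∷ l) (there a∈)  (_ ∷ u , lk , end) = suffixFrom l a∈ (u , Linked.tail lk , end)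

  walk⇒path : ∀ {a b} → Star Rel a b → ∃[ l ] SimplePath a b l
  walk⇒path ε = [] , ([] ∷ []) , [-] , refl
  walk⇒path {a} (_◅_ {j = m} e w) with walk⇒path w
  ... | l , p@(u , lk , end) with a ∈? m ∷ l
  ...   | yes a∈ = suffixFrom l a∈ p
  ...   | no  a∉ = m ∷ l , (¬Any⇒All¬ _ a∉ ∷ u) , (e ∷ lk) , end

  path⇒walk : ∀ {a b} l → Linked Rel (a ∷ l) → last (a ∷ l) ≡ just b → Star Rel a b
  path⇒walk []      _        refl = ε
  path⇒walk (_ ∷ l) (e ∷ lk) end  = e ◅ path⇒walk l lk end

module Prefixes {A : Set} where

  lookup∈take : ∀ (xs : List A) c {i} → toℕ c < i → lookup xs c ∈ take i xs
  lookup∈take (x ∷ xs) Fin.zero    {suc i} _           = here refl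
  lookup∈take (x ∷ xs) (Fin.suc c) {suc i} (s≤s lt)  = there (lookup∈take xs c lt)

  ∈take⇒lookup : ∀ (xs : List A) i {z} → z ∈ take i xs → ∃[ c ] (toℕ c < i × lookup xs c ≡ z)
  ∈take⇒lookup (x ∷ xs) (suc i) (here eq) = Fin.zero , s≤s z≤n , sym eq
  ∈take⇒lookup (x ∷ xs) (suc i) (there m) with ∈take⇒lookup xs i m
  ... | c , lt , eq = Fin.suc c , s≤s lt , eq

  take⊆ : ∀ (xs : List A) i {z} → z ∈ take i xs → z ∈ xs
  take⊆ xs i m with ∈take⇒lookup xs i m
  ... | c , _ , refl = ∈-lookup c

  lookup∉take : ∀ {xs : List A} → Unique xs → ∀ c → lookup xs c ∉ take (toℕ c) xs
  lookup∉take {x ∷ xs} (x∉ ∷ _) (Fin.suc c) (here eq) = All.lookup x∉ (∈-lookup c) (sym eq)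
  lookup∉take {x ∷ xs} (_ ∷ u)  (Fin.suc c) (there m) = lookup∉take u c m

  ∈take-suc : ∀ (xs : List A) c {z} → z ∈ take (suc (toℕ c)) xs ⇔ (z ∈ take (toℕ c) xs ⊎ z ≡ lookup xs c)
  ∈take-suc (x ∷ xs) Fin.zero = mk⇔ (λ { (here eq) → inj₂ eq }) (λ { (inj₂ eq) → here eq })
  ∈take-suc (x ∷ xs) (Fin.suc c) {z} = mk⇔ to from
    where
    open Equivalence (∈take-suc xs c) renaming (to to to′; from to from′)
    to : z ∈ x ∷ take (suc (toℕ c)) xs → z ∈ x ∷ take (toℕ c) xs ⊎ z ≡ lookup xs c
    to (here eq) = inj₁ (here eq)
    to (there m) = Sum.map₁ there (to′ m)
    from : z ∈ x ∷ take (toℕ c) xs ⊎ z ≡ lookup xs c → z ∈ x ∷ take (suc (toℕ c)) xs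
    from (inj₁ (here eq)) = here eq
    from (inj₁ (there m)) = there (from′ (inj₁ m))
    from (inj₂ eq)        = there (from′ (inj₂ eq))

cycle-mono : ∀ {n} {G H : RGraph n} → (∀ {a b} → E G a b → E H a b) → ∀ c → IsCycle G c → IsCycle H c
cycle-mono G⊆H (_ ∷ _ ∷ _ ∷ _) (uq , lk , w , end , e) = uq , Linked.map G⊆H lk , w , end , G⊆H e

module Growth {n : ℕ} (F : RGraph n) where
  open Equivalence

  ParentEdge : List (Fin n) → Fin n → Fin n → Set
  ParentEdge P a b = (a ∈ P × Parent F b a) ⊎ (b ∈ P × Parent F a b)

  Grown : List (Fin n) → RGraph n
  Grown P = addAll F bot P

  AddsVertex : List (Fin n) → List (Fin n) → Fin n → Set
  AddsVertex Q P v = ∀ {z} → z ∈ Q ⇔ (z ∈ P ⊎ z ≡ v)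

  addAll-E : ∀ G us {a b} → E (addAll F G us) a b ⇔ (E G a b ⊎ ParentEdge us a b)
  addAll-E G [] = mk⇔ inj₁ λ { (inj₁ e) → e ; (inj₂ (inj₁ (() , _))) ; (inj₂ (inj₂ (() , _))) }
  addAll-E G (v ∷ us) = mk⇔ (shift ∘ to IH) (from IH ∘ unshift)
    where
    IH : ∀ {a b} → E (addAll F (step F G v) us) a b ⇔ (E (step F G v) a b ⊎ ParentEdge us a b)
    IH = addAll-E (step F G v) us
    shift : ∀ {a b} → E (step F G v) a b ⊎ ParentEdge us a b → E G a b ⊎ ParentEdge (v ∷ us) a b
    shift (inj₁ (inj₁ e))                  = inj₁ e
    shift (inj₁ (inj₂ (inj₁ (refl , ba)))) = inj₂ (inj₁ (here refl , ba))
    shift (inj₁ (inj₂ (inj₂ (refl , ab)))) = inj₂ (inj₂ (here refl , ab))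
    shift (inj₂ (inj₁ (a∈ , ba)))          = inj₂ (inj₁ (there a∈ , ba))
    shift (inj₂ (inj₂ (b∈ , ab)))          = inj₂ (inj₂ (there b∈ , ab))
    unshift : ∀ {a b} → E G a b ⊎ ParentEdge (v ∷ us) a b → E (step F G v) a b ⊎ ParentEdge us a b
    unshift (inj₁ e)                       = inj₁ (inj₁ e)
    unshift (inj₂ (inj₁ (here refl , ba))) = inj₁ (inj₂ (inj₁ (refl , ba)))
    unshift (inj₂ (inj₂ (here refl , ab))) = inj₁ (inj₂ (inj₂ (refl , ab)))
    unshift (inj₂ (inj₁ (there a∈ , ba)))  = inj₂ (inj₁ (a∈ , ba))
    unshift (inj₂ (inj₂ (there b∈ , ab)))  = inj₂ (inj₂ (b∈ , ab))

  addAll-R : ∀ G us {z} → R (addAll F G us) z ⇔ (R G z × z ∉ us)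
  addAll-R G []       = mk⇔ (λ Rz → Rz , λ ()) proj₁
  addAll-R G (v ∷ us) = mk⇔ (shift ∘ to IH) (from IH ∘ unshift)
    where
    IH : ∀ {z} → R (addAll F (step F G v) us) z ⇔ (R (step F G v) z × z ∉ us)
    IH = addAll-R (step F G v) us
    shift : ∀ {z} → R (step F G v) z × z ∉ us → R G z × z ∉ v ∷ us
    shift ((Rz , z≢v) , z∉) = Rz , λ { (here eq) → z≢v eq ; (there z∈) → z∉ z∈ }
    unshift : ∀ {z} → R G z × z ∉ v ∷ us → R (step F G v) z × z ∉ us
    unshift (Rz , z∉) = (Rz , z∉ ∘ here) , z∉ ∘ there

  grown-E : ∀ P {a b} → E (Grown P) a b ⇔ ParentEdge P a b
  grown-E P = mk⇔ ([ (λ ()) , (λ e → e) ] ∘ to (addAll-E bot P)) (from (addAll-E bot P) ∘ inj₂)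

  grown-R : ∀ P {z} → R (Grown P) z ⇔ z ∉ P
  grown-R P = mk⇔ (proj₂ ∘ to (addAll-R bot P)) (λ z∉ → from (addAll-R bot P) (tt , z∉))

module Forest {n : ℕ} {F : RGraph n} (rsf : IsRSF F) where
  open import Data.List.Membership.DecPropositional (_≟_ {n}) using (_∈?_)
  open Paths _≟_ (E F)
  open Growth F
  open Equivalence

  private
    edge-sym : ∀ a b → E F a b → E F b a
    edge-sym = proj₁ rsf
    no-loop : ∀ a → ¬ E F a a
    no-loop = proj₁ (proj₂ rsf)
    acyclic : ∀ c → ¬ IsCycle F c
    acyclic = proj₁ (proj₂ (proj₂ rsf))
    has-root : ∀ x → ∃[ r ] (R F r × Conn F x r)
    has-root = proj₁ (proj₂ (proj₂ (proj₂ rsf)))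
    root-unique : ∀ x r r′ → R F r → R F r′ → Conn F x r → Conn F x r′ → r ≡ r′
    root-unique = proj₂ (proj₂ (proj₂ (proj₂ rsf)))

  rootPath : ∀ x → ∃[ l ] PathToRoot F x (x ∷ l)
  rootPath x with has-root x
  ... | r , Rr , x⇝r with walk⇒path x⇝r
  ...   | l , path = l , r , Rr , refl , path

  pathToRoot-tail : ∀ {x p l} → PathToRoot F x (x ∷ p ∷ l) → PathToRoot F p (p ∷ l)
  pathToRoot-tail (r , Rr , _ , _ ∷ uq , lk , end) = r , Rr , refl , uq , Linked.tail lk , end

  root-or-parent : ∀ x → R F x ⊎ ∃[ p ] Parent F p x
  root-or-parent x with rootPath x
  ... | []    , _ , Rx , _ , _ , _ , refl = inj₁ Rx
  ... | p ∷ l , path                      = inj₂ (p , l , path)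

  parent-edge : ∀ {p x} → Parent F p x → E F x p
  parent-edge (_ , _ , _ , _ , _ , e ∷ _ , _) = e

  parent-irrefl : ∀ {x} → ¬ Parent F x x
  parent-irrefl (_ , _ , _ , _ , x∉ ∷ _ , _) = All.lookup x∉ (here refl) refl

  parent-nonroot : ∀ {p x} → Parent F p x → ¬ R F x
  parent-nonroot {p} {x} (l , r , Rr , _ , x∉ ∷ _ , lk , end) Rx =
    All.lookup x∉ (last∈ p l end) (root-unique x x r Rx Rr ε (path⇒walk (p ∷ l) lk end))

  Avoiding : Fin n → Fin n → Fin n → Set
  Avoiding x a b = E F a b × x ≢ a × x ≢ b

  avoiding-sym : ∀ {x a b} → Avoiding x a b → Avoiding x b a
  avoiding-sym (e , xa , xb) = edge-sym _ _ e , xb , xa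

  module Avoid (x : Fin n) = Paths _≟_ (Avoiding x)

  above-avoids : ∀ {x p l r} → PathFromTo F x r (x ∷ p ∷ l) → Avoid.SimplePath x p r l
  above-avoids (_ , x∉ ∷ uq , _ ∷ lk , end) = uq , avoid x∉ lk , end
    where
    avoid : ∀ {x a l} → All (x ≢_) (a ∷ l) → Linked (E F) (a ∷ l) → Linked (Avoiding x) (a ∷ l)
    avoid _                [-]      = [-]
    avoid (xa ∷ xb ∷ rest) (e ∷ lk) = (e , xa , xb) ∷ avoid (xb ∷ rest) lk

  above-walk : ∀ {x p l r} → PathFromTo F x r (x ∷ p ∷ l) → Star (Avoiding x) p r
  above-walk {x} {l = l} path with above-avoids path
  ... | _ , lk , end = Avoid.path⇒walk x l lk end

  -- Two distinct neighbours of x are not joined by a walk avoiding x: it would close a cycle.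
  no-bypass : ∀ {x p q} → p ≢ q → E F x p → E F x q → ¬ Star (Avoiding x) p q
  no-bypass {x} {p} {q} p≢q xp xq p⇝q with Avoid.walk⇒path x p⇝q
  ... | []    , _  , _  , refl = p≢q refl
  ... | y ∷ l , uq , lk , end  =
    acyclic (x ∷ p ∷ y ∷ l) ((avoided lk ∷ uq) , (xp ∷ Linked.map proj₁ lk) , q , end , edge-sym _ _ xq)
    where
    avoided : ∀ {a b l} → Linked (Avoiding x) (a ∷ b ∷ l) → All (x ≢_) (a ∷ b ∷ l)
    avoided ((_ , xa , xb) ∷ [-])         = xa ∷ xb ∷ []
    avoided ((_ , xa , _)  ∷ lk@(_ ∷ _)) = xa ∷ avoided lk

  -- Parents are unique: two parents of x would be joined above x, avoiding x.
  parent-unique : ∀ {p q x} → Parent F p x → Parent F q x → p ≡ q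
  parent-unique {p} {q} {x} px@(_ , r₁ , Rr₁ , path₁) qx@(_ , r₂ , Rr₂ , path₂) with p ≟ q
  ... | yes p≡q = p≡q
  ... | no  p≢q = ⊥-elim (no-bypass p≢q (parent-edge px) (parent-edge qx)
                     (above-walk path₁ ◅◅ Star.reverse avoiding-sym q⇝r₁))
    where
    walk-of : ∀ {r l} → PathFromTo F x r (x ∷ l) → Star (E F) x r
    walk-of {l = l} (_ , _ , lk , end) = path⇒walk l lk end
    same-root : r₁ ≡ r₂
    same-root = root-unique x r₁ r₂ Rr₁ Rr₂ (walk-of path₁) (walk-of path₂)
    q⇝r₁ : Star (Avoiding x) q r₁
    q⇝r₁ = subst (Star (Avoiding x) q) (sym same-root) (above-walk path₂)

  -- An edge at a vertex a with parent p either leads to p or to a child of a: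
  -- otherwise its other end b would be joined to p above a, avoiding a.
  edge-below-parent : ∀ {p a b} → Parent F p a → E F a b → Parent F b a ⊎ Parent F a b
  edge-below-parent {p} {a} {b} pa@(l , r , Rr , path@(_ , a∉ ∷ uq , lk , end)) ab with p ≟ b
  ... | yes refl = inj₁ pa
  ... | no  p≢b with b ∈? p ∷ l
  ...   | no b∉ = inj₂ (p ∷ l , r , Rr , refl , (b≢a ∷ ¬Any⇒All¬ _ b∉) ∷ a∉ ∷ uq , edge-sym _ _ ab ∷ lk , end)
    where
    b≢a : b ≢ a
    b≢a refl = no-loop _ ab
  ...   | yes b∈ with Avoid.suffixFrom a l b∈ (above-avoids path)
  ...     | s , _ , lk′ , end′ = ⊥-elim (no-bypass p≢b (Linked.head lk) ab
                                    (above-walk path ◅◅ Star.reverse avoiding-sym (Avoid.path⇒walk a s lk′ end′)))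

  edge-is-parent-edge : ∀ {a b} → E F a b → Parent F b a ⊎ Parent F a b
  edge-is-parent-edge {a} {b} ab with root-or-parent a | root-or-parent b
  ... | inj₂ (_ , pa) | _             = edge-below-parent pa ab
  ... | inj₁ _        | inj₂ (_ , pb) = swap (edge-below-parent pb (edge-sym _ _ ab))
  ... | inj₁ Ra       | inj₁ Rb       =
    ⊥-elim (no-loop b (subst (λ z → E F z b) (root-unique a a b Ra Rb ε (ab ◅ ε)) ab))

  no-mutual-parents : ∀ {a b} → Parent F a b → Parent F b a → ⊥
  no-mutual-parents ([] , _ , Ra , _ , _ , _ , refl) ba = parent-nonroot ba Ra
  no-mutual-parents (_ ∷ l , path@(_ , _ , _ , (_ ∷ b≢c ∷ _) ∷ _ , _)) ba =
    b≢c (sym (parent-unique (l , pathToRoot-tail path) ba))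

  parent-ancestor : ∀ {p x} → Parent F p x → Ancestor F p x
  parent-ancestor {p} {x} (l , path) = x ∷ p ∷ l , path , there (here refl)

  Up : Fin n → Fin n → Set
  Up x w = Parent F w x

  climb : ∀ {a x} l → PathToRoot F x (x ∷ l) → a ∈ x ∷ l → Star Up x a
  climb _       _    (here refl) = ε
  climb (p ∷ l) path (there a∈)  = (l , path) ◅ climb l (pathToRoot-tail path) a∈

  ancestor⇒climb : ∀ {a x} → Ancestor F a x → Star Up x a
  ancestor⇒climb (_ ∷ l , (r , Rr , refl , path) , a∈) = climb l (r , Rr , refl , path) a∈

  parentEdge⇒edge : ∀ {P a b} → ParentEdge P a b → E F a b
  parentEdge⇒edge (inj₁ (_ , ba)) = parent-edge ba
  parentEdge⇒edge (inj₂ (_ , ab)) = edge-sym _ _ (parent-edge ab)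

  grown-all : ∀ {P} → (∀ x → (¬ R F x) ⇔ (x ∈ P)) → Grown P ≈G F
  grown-all {P} listed =
    (λ a b → mk⇔ (parentEdge⇒edge ∘ to (grown-E P)) (from (grown-E P) ∘ edge⇒parentEdge)) ,
    (λ z → mk⇔ (unlisted⇒root ∘ to (grown-R P)) (from (grown-R P) ∘ root⇒unlisted))
    where
    edge⇒parentEdge : ∀ {a b} → E F a b → ParentEdge P a b
    edge⇒parentEdge ab with edge-is-parent-edge ab
    ... | inj₁ ba = inj₁ (to (listed _) (parent-nonroot ba) , ba)
    ... | inj₂ ab = inj₂ (to (listed _) (parent-nonroot ab) , ab)
    unlisted⇒root : ∀ {z} → z ∉ P → R F z
    unlisted⇒root {z} z∉ with root-or-parent z
    ... | inj₁ Rz       = Rz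
    ... | inj₂ (_ , pz) = ⊥-elim (z∉ (to (listed z) (parent-nonroot pz)))
    root⇒unlisted : ∀ {z} → R F z → z ∉ P
    root⇒unlisted {z} Rz z∈ = from (listed z) z∈ Rz

  module _ (P : List (Fin n)) (P-nonroot : ∀ {x} → x ∈ P → ¬ R F x) where
    private
      module G = Paths _≟_ (E (Grown P))

    grown-sym : ∀ a b → E (Grown P) a b → E (Grown P) b a
    grown-sym _ _ = from (grown-E P) ∘ swap ∘ to (grown-E P)

    -- Climbing the root path of x in F, the first vertex outside P is a root of Grown P.
    climb-to-root : ∀ {x} l → PathToRoot F x (x ∷ l) → ∃[ r ] (R (Grown P) r × Conn (Grown P) x r)
    climb-to-root {x} l path with x ∈? P
    ... | no x∉ = x , from (grown-R P) x∉ , ε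
    climb-to-root []      (_ , Rx , _ , _ , _ , refl) | yes x∈ = ⊥-elim (P-nonroot x∈ Rx)
    climb-to-root (p ∷ l) path                        | yes x∈ with climb-to-root l (pathToRoot-tail path)
    ... | r , Rr , p⇝r = r , Rr , from (grown-E P) (inj₁ (x∈ , l , path)) ◅ p⇝r

    -- A simple path in Grown P that steps down from w to a child u ∈ P keeps
    -- stepping down (u has no other parent) and so ends inside P.
    descent : ∀ {w u z} L → Unique (w ∷ u ∷ L) → Linked (E (Grown P)) (u ∷ L) →
              last (u ∷ L) ≡ just z → u ∈ P → Parent F w u → z ∈ P
    descent []      _          _        refl u∈ _  = u∈
    descent (y ∷ L) (w∉ ∷ uq) (e ∷ lk) end  u∈ wu with to (grown-E P) e
    ... | inj₁ (_ , yu)  = ⊥-elim (All.lookup w∉ (there (here refl)) (sym (parent-unique yu wu)))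
    ... | inj₂ (y∈ , uy) = descent L uq lk end y∈ uy

    -- Two roots of Grown P in one component coincide: a simple path between
    -- them must leave the first root downwards, hence end inside P.
    grown-root-unique : ∀ x r r′ → R (Grown P) r → R (Grown P) r′ →
                        Conn (Grown P) x r → Conn (Grown P) x r′ → r ≡ r′
    grown-root-unique _ _ _ Rr Rr′ x⇝r x⇝r′
      with G.walk⇒path (Star.reverse (grown-sym _ _) x⇝r ◅◅ x⇝r′)
    ... | []    , _  , _        , refl = refl
    ... | y ∷ L , uq , (e ∷ lk) , end with to (grown-E P) e
    ...   | inj₁ (r∈ , _)  = ⊥-elim (to (grown-R P) Rr r∈)
    ...   | inj₂ (y∈ , ry) = ⊥-elim (to (grown-R P) Rr′ (descent L uq lk end y∈ ry))

    grown-isRSF : IsRSF (Grown P)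
    grown-isRSF =
      grown-sym ,
      (λ a → no-loop a ∘ parentEdge⇒edge ∘ to (grown-E P)) ,
      (λ c → acyclic c ∘ cycle-mono (parentEdge⇒edge ∘ to (grown-E P)) c) ,
      (λ x → climb-to-root _ (proj₂ (rootPath x))) ,
      grown-root-unique

  grown-cover : ∀ {P Q v p} → AddsVertex Q P v → v ∉ P → Parent F p v → p ∉ P → Grown P ⋖ Grown Q
  grown-cover {P} {Q} {v} {p} Q=P+v v∉ pv p∉ =
    p , v , from (grown-R P) p∉ , from (grown-R P) v∉ , p≢v ,
    (λ a b → mk⇔ (Sum.map₁ (from (grown-E P)) ∘ split ∘ to (grown-E Q))
                 (from (grown-E Q) ∘ join ∘ Sum.map₁ (to (grown-E P)))) ,
    (λ z → mk⇔ (shrink ∘ to (grown-R Q)) (from (grown-R Q) ∘ unshrink))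
    where
    p≢v : p ≢ v
    p≢v refl = parent-irrefl pv
    widen : ∀ {z} → z ∈ P → z ∈ Q
    widen = from Q=P+v ∘ inj₁
    v∈Q : v ∈ Q
    v∈Q = from Q=P+v (inj₂ refl)
    split : ∀ {a b} → ParentEdge Q a b → ParentEdge P a b ⊎ (a ≡ p × b ≡ v) ⊎ (a ≡ v × b ≡ p)
    split (inj₁ (a∈ , ba)) with to Q=P+v a∈
    ... | inj₁ a∈P = inj₁ (inj₁ (a∈P , ba))
    ... | inj₂ refl = inj₂ (inj₂ (refl , parent-unique ba pv))
    split (inj₂ (b∈ , ab)) with to Q=P+v b∈
    ... | inj₁ b∈P = inj₁ (inj₂ (b∈P , ab))
    ... | inj₂ refl = inj₂ (inj₁ (parent-unique ab pv , refl))
    join : ∀ {a b} → ParentEdge P a b ⊎ (a ≡ p × b ≡ v) ⊎ (a ≡ v × b ≡ p) → ParentEdge Q a b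
    join (inj₁ (inj₁ (a∈ , ba)))     = inj₁ (widen a∈ , ba)
    join (inj₁ (inj₂ (b∈ , ab)))     = inj₂ (widen b∈ , ab)
    join (inj₂ (inj₁ (refl , refl))) = inj₂ (v∈Q , pv)
    join (inj₂ (inj₂ (refl , refl))) = inj₁ (v∈Q , pv)
    shrink : ∀ {z} → z ∉ Q → R (Grown P) z × z ≢ v
    shrink z∉Q = from (grown-R P) (z∉Q ∘ widen) , z∉Q ∘ from Q=P+v ∘ inj₂
    unshrink : ∀ {z} → R (Grown P) z × z ≢ v → z ∉ Q
    unshrink (Rz , z≢v) = [ to (grown-R P) Rz , z≢v ] ∘ to Q=P+v

  -- Conversely, if Grown P ⋖ Grown Q then the new edge {v, p} joins two roots
  -- of Grown P (it cannot be an old edge), so p ∉ P.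
  cover⇒parent-unlisted : ∀ {P Q v p} → AddsVertex Q P v → v ∉ P → Parent F p v → Grown P ⋖ Grown Q → p ∉ P
  cover⇒parent-unlisted {P} {Q} {v} {p} Q=P+v v∉ pv (x , y , Rx , Ry , _ , edges , _)
    with to (edges v p) (from (grown-E Q) (inj₁ (from Q=P+v (inj₂ refl) , pv)))
  ... | inj₂ (inj₁ (_ , refl)) = to (grown-R P) Ry
  ... | inj₂ (inj₂ (_ , refl)) = to (grown-R P) Rx
  ... | inj₁ old with to (grown-E P) old
  ...   | inj₁ (v∈ , _) = ⊥-elim (v∉ v∈)
  ...   | inj₂ (_ , vp) = ⊥-elim (no-mutual-parents vp pv)

module Listing {n : ℕ} {F : RGraph n} (rsf : IsRSF F) {vs : List (Fin n)} (listing : IsListing F vs) where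
  open Forest rsf
  open Growth F
  open Prefixes
  open Equivalence

  private
    V : ℕ
    V = length vs
    v : Fin V → Fin n
    v = lookup vs
    v-new : ∀ c → v c ∉ take (toℕ c) vs
    v-new = lookup∉take (proj₁ listing)

  listed : ∀ {x} → ¬ R F x → ∃[ c ] (v c ≡ x)
  listed nr = index x∈ , sym (lookup-index x∈)
    where x∈ = to (proj₂ listing _) nr

  prefix-nonroot : ∀ i {x} → x ∈ take i vs → ¬ R F x
  prefix-nonroot i = from (proj₂ listing _) ∘ take⊆ vs i

  chain-final : chainF F vs V ≈G F
  chain-final = subst (λ P → Grown P ≈G F) (sym (take-all V vs ℕ.≤-refl)) (grown-all (proj₂ listing))

  ParentsLater : Set
  ParentsLater = ∀ c {p} → Parent F p (v c) → p ∉ take (toℕ c) vs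

  saturated⇒parentsLater : SaturatedChain (chainF F vs) V → ParentsLater
  saturated⇒parentsLater (_ , covers) c pv =
    cover⇒parent-unlisted (∈take-suc vs c) (v-new c) pv (covers (toℕ c) (Fin.toℕ<n c))

  parentsLater⇒saturated : ParentsLater → SaturatedChain (chainF F vs) V
  parentsLater⇒saturated later = (λ i _ → grown-isRSF (take i vs) (prefix-nonroot i)) , cover
    where
    cover-at : ∀ c → chainF F vs (toℕ c) ⋖ chainF F vs (suc (toℕ c))
    cover-at c with root-or-parent (v c)
    ... | inj₁ Rv       = ⊥-elim (prefix-nonroot (suc (toℕ c)) (lookup∈take vs c ℕ.≤-refl) Rv)
    ... | inj₂ (_ , pv) = grown-cover (∈take-suc vs c) (v-new c) pv (later c pv)
    cover : ∀ i → i < V → chainF F vs i ⋖ chainF F vs (suc i)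
    cover i lt = subst (λ j → chainF F vs j ⋖ chainF F vs (suc j)) (Fin.toℕ-fromℕ< lt) (cover-at (fromℕ< lt))

  parent-later : ParentsLater → ∀ c d → Parent F (v d) (v c) → toℕ c < toℕ d
  parent-later later c d dc = ℕ.≤∧≢⇒< (ℕ.≮⇒≥ (later c dc ∘ lookup∈take vs d)) c≢d
    where
    c≢d : toℕ c ≢ toℕ d
    c≢d eq = parent-irrefl (subst (λ e → Parent F (v e) (v c)) (sym (Fin.toℕ-injective eq)) dc)

  climb-later : ParentsLater → ∀ c d {w} → Up (v c) w → Star Up w (v d) → toℕ c < toℕ d
  climb-later later c d cw ε = parent-later later c d cw
  climb-later later c d cw (wu ◅ rest) with listed (parent-nonroot wu)
  ... | c′ , refl = ℕ.<-trans (parent-later later c c′ cw) (climb-later later c′ d wu rest)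

  linearExt⇒parentsLater : IsLinearExt F vs → ParentsLater
  linearExt⇒parentsLater lin c {p} pv p∈ with ∈take⇒lookup vs (toℕ c) p∈
  ... | d , d<c , refl =
    ℕ.<-asym d<c (lin c d (λ eq → parent-irrefl (subst (Parent F (v d)) eq pv)) (parent-ancestor pv))

  parentsLater⇒linearExt : ParentsLater → IsLinearExt F vs
  parentsLater⇒linearExt later i j vi≢vj anc with first-step vi≢vj (ancestor⇒climb anc)
    where
    first-step : ∀ {x a} → x ≢ a → Star Up x a → ∃[ w ] (Up x w × Star Up w a)
    first-step x≢x ε       = ⊥-elim (x≢x refl)
    first-step _   (e ◅ s) = _ , e , s
  ... | _ , e , s = climb-later later i j e s

lemma5p11 : (n : ℕ) (F : RGraph n) → IsRSF F →
    (vs : List (Fin n)) → IsListing F vs →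
    (chainF F vs (length vs) ≈G F) ×
    (SaturatedChain (chainF F vs) (length vs) ⇔ IsLinearExt F vs)
lemma5p11 n F rsf vs listing =
  chain-final ,
  mk⇔ (parentsLater⇒linearExt ∘ saturated⇒parentsLater)
      (parentsLater⇒saturated ∘ linearExt⇒parentsLater)
  where open Listing rsf listing
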